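{- Let $k\ge 3$ and let $G=(A\cup B,E)$ be an odd $k$-melon graph, where $(A,B)$ is its bipartition. Then $\mathrm{evc}(G)=\mathrm{vc}(G)$, and the family $\mathcal{U}=\{A,B\}$ is a minimum eternal vertex cover class of $G$.
   Context: For $k\ge1$, a $k$-melon graph is the union of $k$ pairwise internally vertex-disjoint paths, each of length at least $1$, all having the same two distinct endpoints $s$ and $t$; it is odd if every path has odd length (such a graph is connected and bipartite). $\mathrm{vc}(G)$ is the minimum cardinality of a vertex cover of $G$. Eternal vertex cover: for a vertex cover $U$ of $G=(V,E)$ and an edge $e=vw$, a defense of $U$ against the attack on $e$ is a one-to-one map $\phi:U\to V$ with $\phi(u)\in N[u]$ (closed neighborhood) for all $u\in U$ such that $\phi(v)=w$ (with $v\in U$) or $\phi(w)=v$ (with $w\in U$). An eternal vertex cover class is a family $\mathcal{U}$ of vertex covers of $G$ of equal cardinality (its size) such that for every $U\in\mathcal{U}$ and every edge $e$ there is a defense $\phi$ of $U$ against $e$ with $\phi(U)\in\mathcal{U}$. $\mathrm{evc}(G)$ is the minimum size of an eternal vertex cover class; a minimum eternal vertex cover class is one of size $\mathrm{evc}(G)$. -}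

module Defs where

open import Data.Nat using (ℕ; _≤_; _∸_)
open import Data.Nat.Properties using ()
open import Data.Fin using (Fin)
open import Data.Fin.Subset using (Subset; _∈_; ∣_∣)
open import Data.List using (List; []; _∷_; _++_; length)
open import Data.List.Relation.Unary.Unique.Propositional using (Unique)
import Data.List.Membership.Propositional as LM
open import Data.Product using (Σ; ∃; _×_; _,_)
open import Data.Sum using (_⊎_)
open import Data.Empty using (⊥)
open import Relation.Nullary using (¬_)
open import Relation.Binary.PropositionalEquality using (_≡_; _≢_)

record Graph : Set₁ where
  field
    n      : ℕ
    Adj    : Fin n → Fin n → Set
    sym    : ∀ {u v} → Adj u v → Adj v u
    irrefl : ∀ {u} → ¬ Adj u u
open Graph public

module _ (G : Graph) where
  private
    V = Fin (n G)
    E = Adj G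

  data WalkFT : V → V → List V → Set where
    single : ∀ v → WalkFT v v (v ∷ [])
    step   : ∀ {u v w p} → E u v → WalkFT v w p → WalkFT u w (u ∷ p)

  IsPath : V → V → List V → Set
  IsPath s t p = WalkFT s t p × Unique p

  pathLength : List V → ℕ
  pathLength p = length p ∸ 1

  Consecutive : V → V → List V → Set
  Consecutive u v p =
    (∃ λ xs → ∃ λ ys → p ≡ xs ++ u ∷ v ∷ ys) ⊎ (∃ λ xs → ∃ λ ys → p ≡ xs ++ v ∷ u ∷ ys)

  data Odd : ℕ → Set where
    one   : Odd 1
    plus2 : ∀ {m} → Odd m → Odd (Data.Nat.suc (Data.Nat.suc m))

  IsOddMelon : ℕ → Set
  IsOddMelon k =
    Σ V λ s → Σ V λ t → s ≢ t ×
    Σ (Fin k → List V) λ P →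
      (∀ i → IsPath s t (P i)) ×
      (∀ i → Odd (pathLength (P i))) ×
      (∀ i j → i ≢ j → P i ≢ P j) ×
      (∀ i j → i ≢ j → ∀ v → v LM.∈ P i → v LM.∈ P j → v ≡ s ⊎ v ≡ t) ×
      (∀ v → ∃ λ i → v LM.∈ P i) ×
      (∀ u v → E u v → ∃ λ i → Consecutive u v (P i))

  IsBipartition : Subset (n G) → Subset (n G) → Set
  IsBipartition A B =
    (∀ v → v ∈ A ⊎ v ∈ B) ×
    (∀ v → v ∈ A → v ∈ B → ⊥) ×
    (∀ u v → E u v → (u ∈ A × v ∈ B) ⊎ (u ∈ B × v ∈ A))

  IsVertexCover : Subset (n G) → Set
  IsVertexCover U = ∀ u v → E u v → u ∈ U ⊎ v ∈ U

  IsVCNumber : ℕ → Set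
  IsVCNumber m =
    (Σ (Subset (n G)) λ U → IsVertexCover U × ∣ U ∣ ≡ m) ×
    (∀ U → IsVertexCover U → m ≤ ∣ U ∣)

  IsDefense : Subset (n G) → V → V → (V → V) → Set
  IsDefense U u v φ =
    (∀ x → x ∈ U → φ x ≡ x ⊎ E x (φ x)) ×
    (∀ x y → x ∈ U → y ∈ U → φ x ≡ φ y → x ≡ y) ×
    ((u ∈ U × φ u ≡ v) ⊎ (v ∈ U × φ v ≡ u))

  IsImage : Subset (n G) → (V → V) → Subset (n G) → Set
  IsImage U φ W = ∀ w → (w ∈ W → ∃ λ x → x ∈ U × φ x ≡ w) × ((∃ λ x → x ∈ U × φ x ≡ w) → w ∈ W)

  IsEVCClass : (Subset (n G) → Set) → ℕ → Set
  IsEVCClass 𝒰 m =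
    (∃ λ U → 𝒰 U) ×
    (∀ U → 𝒰 U → IsVertexCover U × ∣ U ∣ ≡ m) ×
    (∀ U → 𝒰 U → ∀ u v → E u v →
       Σ (V → V) λ φ → IsDefense U u v φ × Σ (Subset (n G)) λ W → 𝒰 W × IsImage U φ W)

  IsEVCNumber : ℕ → Set₁
  IsEVCNumber m =
    (Σ (Subset (n G) → Set) λ 𝒰 → IsEVCClass 𝒰 m) ×
    (∀ 𝒰 m' → IsEVCClass 𝒰 m' → m ≤ m')

{-# OPTIONS --safe #-}
-- Each path Pⱼ of the melon yields a perfect matching Mⱼ: pair up consecutive vertices along
-- Pⱼ (it has an even number of them) and, on every other path, along its inner vertices (those
-- strictly between s and t, again an even number). An edge at an even position of its path Pᵢ
-- lies in Mᵢ, one at an odd position lies in Mⱼ for every j ≠ i, so two paths already suffice.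
-- In a bipartite graph with a perfect matching, |A| = |B| and every vertex cover has at least
-- |A| vertices. If moreover every edge lies in a perfect matching, the guards on one side answer
-- an attack on uv by all moving along a perfect matching containing uv, which carries that side
-- onto the other. So {A, B} is an eternal vertex cover class of size |A| = vc(G), which is
-- optimal because every member of such a class is a vertex cover.
module Submission where

open import Defs hiding (sym)
open import Data.Nat using (ℕ; suc; _≤_; z≤n; s≤s)
open import Data.Nat.Properties using (≤-antisym; ≤-trans)
open import Data.Fin using (Fin; zero; suc; _≟_)
import Data.Fin.Properties as Fin
import Data.Fin.Subset as Subset
open Subset using (Subset; ∣_∣; inside; outside; _-_)
open import Data.Fin.Subset.Properties using (x∈p⇒∣p-x∣<∣p∣; x∈p∧x≢y⇒x∈p-y)
open import Data.List using (List; []; _∷_; _++_; length; drop)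
open import Data.List.Membership.Propositional using (_∈_; _∉_)
open import Data.List.Membership.Propositional.Properties using (∈-++⁺ʳ)
open import Data.List.Relation.Unary.Any using (here; there)
import Data.List.Relation.Unary.AllPairs as AllPairs
open import Data.List.Relation.Unary.Unique.Propositional using (Unique)
open import Data.List.Relation.Unary.Unique.Propositional.Properties
  using (drop⁺; Unique[x∷xs]⇒x∉xs)
import Data.Vec as Vec
open import Data.Product using (Σ; ∃; _×_; _,_; proj₁; proj₂)
open import Data.Sum using (_⊎_; inj₁; inj₂; [_,_])
import Data.Sum as Sum
open import Data.Empty using (⊥)
open import Function using (_∘_; id)
open import Relation.Nullary using (yes; no; contradiction)
open import Relation.Binary.Definitions using (DecidableEquality)
open import Relation.Binary.PropositionalEquality
  using (_≡_; _≢_; refl; sym; trans; cong; subst; ≢-sym; module ≡-Reasoning)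

injectiveOn⇒∣p∣≤∣q∣ : ∀ {m m′} (p : Subset m) (q : Subset m′) (f : Fin m → Fin m′) →
  (∀ {x} → x Subset.∈ p → f x Subset.∈ q) →
  (∀ {x y} → x Subset.∈ p → y Subset.∈ p → f x ≡ f y → x ≡ y) →
  ∣ p ∣ ≤ ∣ q ∣
injectiveOn⇒∣p∣≤∣q∣ Vec.[] q f into injective = z≤n
injectiveOn⇒∣p∣≤∣q∣ (outside Vec.∷ p) q f into injective =
  injectiveOn⇒∣p∣≤∣q∣ p q (f ∘ suc) (into ∘ Vec.there)
    (λ x∈p y∈p → Fin.suc-injective ∘ injective (Vec.there x∈p) (Vec.there y∈p))
injectiveOn⇒∣p∣≤∣q∣ (inside Vec.∷ p) q f into injective =
  ≤-trans (s≤s (injectiveOn⇒∣p∣≤∣q∣ p (q - f zero) (f ∘ suc) into′ injective′))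
          (x∈p⇒∣p-x∣<∣p∣ (into Vec.here))
  where
  injective′ : ∀ {x y} → x Subset.∈ p → y Subset.∈ p → f (suc x) ≡ f (suc y) → x ≡ y
  injective′ x∈p y∈p = Fin.suc-injective ∘ injective (Vec.there x∈p) (Vec.there y∈p)
  into′ : ∀ {x} → x Subset.∈ p → f (suc x) Subset.∈ q - f zero
  into′ x∈p = x∈p∧x≢y⇒x∈p-y (into (Vec.there x∈p))
                (λ eq → Fin.0≢1+n (sym (injective (Vec.there x∈p) Vec.here eq)))

unique-head-≢ : ∀ {a} {A : Set a} {c x : A} {q} → Unique (c ∷ q) → x ∈ q → x ≢ c
unique-head-≢ {q = q} c∷q-unique x∈q x≡c =
  Unique[x∷xs]⇒x∉xs c∷q-unique (subst (_∈ q) x≡c x∈q)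

module Pairing {a} {A : Set a} (_≟_ : DecidableEquality A) where

  open import Data.List.Membership.DecPropositional _≟_ using (_∈?_)

  partner : List A → A → A
  partner (u ∷ v ∷ r) x with x ≟ u | x ≟ v
  ... | yes _ | _     = v
  ... | no _  | yes _ = u
  ... | no _  | no _  = partner r x
  partner _ x = x

  partner-head : ∀ u v r → partner (u ∷ v ∷ r) u ≡ v
  partner-head u v r with u ≟ u
  ... | yes _   = refl
  ... | no u≢u  = contradiction refl u≢u

  partner-second : ∀ {u v} r → v ≢ u → partner (u ∷ v ∷ r) v ≡ u
  partner-second {u} {v} r v≢u with v ≟ u | v ≟ v
  ... | yes v≡u | _       = contradiction v≡u v≢u
  ... | no _    | yes _   = refl
  ... | no _    | no v≢v  = contradiction refl v≢v

  partner-skip : ∀ {u v x} r → x ≢ u → x ≢ v → partner (u ∷ v ∷ r) x ≡ partner r x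
  partner-skip {u} {v} {x} r x≢u x≢v with x ≟ u | x ≟ v
  ... | yes x≡u | _       = contradiction x≡u x≢u
  ... | no _    | yes x≡v = contradiction x≡v x≢v
  ... | no _    | no _    = refl

  ∈-pair⁻ : ∀ {u v x : A} {r} → x ∈ u ∷ v ∷ r → x ≢ u → x ≢ v → x ∈ r
  ∈-pair⁻ (here x≡u)          x≢u _   = contradiction x≡u x≢u
  ∈-pair⁻ (there (here x≡v))  _   x≢v = contradiction x≡v x≢v
  ∈-pair⁻ (there (there x∈r)) _   _   = x∈r

  partner-∉ : ∀ {x} q → x ∉ q → partner q x ≡ x
  partner-∉ []          _   = refl
  partner-∉ (_ ∷ [])    _   = refl
  partner-∉ (u ∷ v ∷ r) x∉q =
    trans (partner-skip r (x∉q ∘ here) (x∉q ∘ there ∘ here))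
          (partner-∉ r (x∉q ∘ there ∘ there))

  partner-∈ : ∀ {x} q → x ∈ q → partner q x ∈ q
  partner-∈ (_ ∷ []) x∈q = x∈q
  partner-∈ {x} (u ∷ v ∷ r) x∈q with x ≟ u | x ≟ v
  ... | yes _   | _       = there (here refl)
  ... | no _    | yes _   = here refl
  ... | no x≢u  | no x≢v  = there (there (partner-∈ r (∈-pair⁻ x∈q x≢u x≢v)))

  moved⇒∈ : ∀ {x} q → partner q x ≢ x → x ∈ q
  moved⇒∈ {x} q moved with x ∈? q
  ... | yes x∈q = x∈q
  ... | no x∉q  = contradiction (partner-∉ q x∉q) moved

  partner-≢ : ∀ {w x} q → w ∉ q → x ≢ w → partner q x ≢ w
  partner-≢ {w} {x} q w∉q x≢w partner≡w with x ∈? q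
  ... | yes x∈q = w∉q (subst (_∈ q) partner≡w (partner-∈ q x∈q))
  ... | no x∉q  = x≢w (trans (sym (partner-∉ q x∉q)) partner≡w)

  partner-involutive : ∀ {q} → Unique q → ∀ x → partner q (partner q x) ≡ x
  partner-involutive {[]}     _ x = refl
  partner-involutive {_ ∷ []} _ x = refl
  partner-involutive {u ∷ v ∷ r} q-unique x with x ≟ u | x ≟ v
  ... | yes refl | _        = partner-second r (unique-head-≢ q-unique (here refl))
  ... | no _     | yes refl = partner-head u v r
  ... | no x≢u   | no x≢v   = begin
    partner (u ∷ v ∷ r) (partner r x)
      ≡⟨ partner-skip r (partner-≢ r u∉r x≢u) (partner-≢ r v∉r x≢v) ⟩
    partner r (partner r x)
      ≡⟨ partner-involutive r-unique x ⟩
    x ∎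
    where
    open ≡-Reasoning
    r-unique : Unique r
    r-unique = AllPairs.tail (AllPairs.tail q-unique)
    u∉r : u ∉ r
    u∉r u∈r = unique-head-≢ q-unique (there u∈r) refl
    v∉r : v ∉ r
    v∉r v∈r = unique-head-≢ (AllPairs.tail q-unique) v∈r refl

  -- uv is a pair of the pairing of q if xs has even length, of the pairing of drop 1 q if odd.
  partner-consecutive : ∀ xs {u v ys q} → q ≡ xs ++ u ∷ v ∷ ys → Unique q →
                        partner q u ≡ v ⊎ partner (drop 1 q) u ≡ v
  partner-consecutive []       refl _ = inj₁ (partner-head _ _ _)
  partner-consecutive (_ ∷ []) refl _ = inj₂ (partner-head _ _ _)
  partner-consecutive (c ∷ d ∷ []) refl q-unique =
    inj₁ (trans (partner-skip _ (unique-head-≢ q-unique (there (here refl)))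
                                (unique-head-≢ (AllPairs.tail q-unique) (here refl)))
                (partner-head _ _ _))
  partner-consecutive (c ∷ d ∷ e ∷ xs) {u} {v} {ys} refl q-unique =
    Sum.map (trans (partner-skip _ u≢c u≢d)) (trans (partner-skip _ u≢d u≢e))
            (partner-consecutive (e ∷ xs) refl e∷-unique)
    where
    d∷-unique : Unique (d ∷ e ∷ xs ++ u ∷ v ∷ ys)
    d∷-unique = AllPairs.tail q-unique
    e∷-unique : Unique (e ∷ xs ++ u ∷ v ∷ ys)
    e∷-unique = AllPairs.tail d∷-unique
    u∈ : u ∈ xs ++ u ∷ v ∷ ys
    u∈ = ∈-++⁺ʳ xs (here refl)
    u≢c : u ≢ c
    u≢c = unique-head-≢ q-unique (there (there u∈))
    u≢d : u ≢ d
    u≢d = unique-head-≢ d∷-unique (there u∈)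
    u≢e : u ≢ e
    u≢e = unique-head-≢ e∷-unique u∈

module Walks (G : Graph) where

  open Pairing (_≟_ {n G})

  start∈ : ∀ {u w q} → WalkFT G u w q → u ∈ q
  start∈ (single _) = here refl
  start∈ (step _ _) = here refl

  end∈ : ∀ {u w q} → WalkFT G u w q → w ∈ q
  end∈ (single _)    = here refl
  end∈ (step _ walk) = there (end∈ walk)

  partner-pair-adjacent : ∀ {u v x r} → Adj G u v → x ∈ u ∷ v ∷ r →
                          (x ∈ r → Adj G x (partner r x)) → Adj G x (partner (u ∷ v ∷ r) x)
  partner-pair-adjacent {u} {v} {x} uv x∈q adjacent-in-r with x ≟ u | x ≟ v
  ... | yes refl | _        = uv
  ... | no _     | yes refl = Graph.sym G uv
  ... | no x≢u   | no x≢v   = adjacent-in-r (∈-pair⁻ x∈q x≢u x≢v)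

  partner-adjacent : ∀ {u w q x} → WalkFT G u w q → x ∈ q → x ≢ w → Adj G x (partner q x)
  partner-adjacent (single _)              (here x≡w) x≢w = contradiction x≡w x≢w
  partner-adjacent (step uv (single _))    x∈q        _   = partner-pair-adjacent uv x∈q (λ ())
  partner-adjacent (step uv (step _ walk)) x∈q        x≢w =
    partner-pair-adjacent uv x∈q (λ x∈r → partner-adjacent walk x∈r x≢w)

  partner-end-adjacent : ∀ {u w q} → WalkFT G u w q → Odd G (pathLength G q) → Adj G w (partner q w)
  partner-end-adjacent (step uv (single _)) one = partner-pair-adjacent uv (there (here refl)) (λ ())
  partner-end-adjacent (step uv (step _ (single _))) (plus2 ())
  partner-end-adjacent (step uv (step _ walk@(step _ _))) (plus2 odd) =
    partner-pair-adjacent uv (there (there (end∈ walk))) (λ _ → partner-end-adjacent walk odd)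

  partner-end-fixed : ∀ {u w q} → WalkFT G u w q → Unique q → Odd G (length q) → partner q w ≡ w
  partner-end-fixed (single _)               _        one         = refl
  partner-end-fixed (step _ (single _))      _        (plus2 ())
  partner-end-fixed (step _ (step _ walk))   q-unique (plus2 odd) =
    trans (partner-skip _ (unique-head-≢ q-unique (there (end∈ walk)))
                          (unique-head-≢ (AllPairs.tail q-unique) (end∈ walk)))
          (partner-end-fixed walk (AllPairs.tail (AllPairs.tail q-unique)) odd)

  oddWalk-partner-adjacent : ∀ {u w p x} → WalkFT G u w p → Odd G (pathLength G p) → x ∈ p →
                             Adj G x (partner p x)
  oddWalk-partner-adjacent {w = w} {x = x} walk odd x∈p with x ≟ w
  ... | yes refl = partner-end-adjacent walk odd
  ... | no x≢w   = partner-adjacent walk x∈p x≢w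

  ∈-drop1 : ∀ {u w p x} → WalkFT G u w p → x ∈ p → x ≢ u → x ∈ drop 1 p
  ∈-drop1 (single _) (here x≡u)  x≢u = contradiction x≡u x≢u
  ∈-drop1 (step _ _) (here x≡u)  x≢u = contradiction x≡u x≢u
  ∈-drop1 (step _ _) (there x∈q) _   = x∈q

  drop1-∈⁻ : ∀ {u w p x} → WalkFT G u w p → x ∈ drop 1 p → x ∈ p
  drop1-∈⁻ (step _ _) = there

  start∉drop1 : ∀ {u w p} → WalkFT G u w p → Unique p → u ∉ drop 1 p
  start∉drop1 (step _ _) p-unique = Unique[x∷xs]⇒x∉xs p-unique

  drop1-partner-adjacent : ∀ {u w p x} → WalkFT G u w p → x ∈ drop 1 p → x ≢ w →
                           Adj G x (partner (drop 1 p) x)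
  drop1-partner-adjacent (step _ walk) = partner-adjacent walk

  oddWalk-drop1-partner-end : ∀ {u w p} → WalkFT G u w p → Unique p → Odd G (pathLength G p) →
                              partner (drop 1 p) w ≡ w
  oddWalk-drop1-partner-end (step _ walk) p-unique odd =
    partner-end-fixed walk (AllPairs.tail p-unique) odd

record PerfectMatching (G : Graph) : Set where
  field
    mate            : Fin (n G) → Fin (n G)
    mate-adjacent   : ∀ x → Adj G x (mate x)
    mate-involutive : ∀ x → mate (mate x) ≡ x

  mate-injective : ∀ {x y} → mate x ≡ mate y → x ≡ y
  mate-injective {x} {y} mx≡my = begin
    x              ≡⟨ mate-involutive x ⟨
    mate (mate x)  ≡⟨ cong mate mx≡my ⟩
    mate (mate y)  ≡⟨ mate-involutive y ⟩
    y              ∎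
    where open ≡-Reasoning

open PerfectMatching public

EveryEdgeInPerfectMatching : Graph → Set
EveryEdgeInPerfectMatching G =
  ∀ u v → Adj G u v → Σ (PerfectMatching G) λ M → mate M u ≡ v

module OddMelon (G : Graph) {k : ℕ} {s t : Fin (n G)} (P : Fin k → List (Fin (n G)))
  (path : ∀ i → IsPath G s t (P i)) (odd : ∀ i → Odd G (pathLength G (P i)))
  (internally-disjoint : ∀ i j → i ≢ j → ∀ v → v ∈ P i → v ∈ P j → v ≡ s ⊎ v ≡ t)
  (cover : ∀ v → ∃ λ i → v ∈ P i) where

  open Pairing (_≟_ {n G})
  open Walks G
  open import Data.List.Membership.DecPropositional (_≟_ {n G}) using (_∈?_)

  private
    V : Set
    V = Fin (n G)

  P⁻ : Fin k → List V
  P⁻ i = drop 1 (P i)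

  Inner : Fin k → V → Set
  Inner i x = x ∈ P⁻ i × x ≢ t

  module _ {i : Fin k} where

    private
      walk : WalkFT G s t (P i)
      walk = proj₁ (path i)
      P-unique : Unique (P i)
      P-unique = proj₂ (path i)
      P⁻-unique : Unique (P⁻ i)
      P⁻-unique = drop⁺ 1 P-unique
      t-fixed : partner (P⁻ i) t ≡ t
      t-fixed = oddWalk-drop1-partner-end walk P-unique (odd i)

    inner⇒∈ : ∀ {x} → Inner i x → x ∈ P i
    inner⇒∈ (x∈P⁻ , _) = drop1-∈⁻ walk x∈P⁻

    inner⇒≢s : ∀ {x} → Inner i x → x ≢ s
    inner⇒≢s (x∈P⁻ , _) refl = start∉drop1 walk P-unique x∈P⁻

    inner-adjacent : ∀ {x} → Inner i x → Adj G x (partner (P⁻ i) x)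
    inner-adjacent (x∈P⁻ , x≢t) = drop1-partner-adjacent walk x∈P⁻ x≢t

    inner-involutive : ∀ x → partner (P⁻ i) (partner (P⁻ i) x) ≡ x
    inner-involutive = partner-involutive P⁻-unique

    moved⇒inner : ∀ {x} → partner (P⁻ i) x ≢ x → Inner i x
    moved⇒inner moved = moved⇒∈ (P⁻ i) moved , λ { refl → moved t-fixed }

    partner-inner : ∀ {x} → Inner i x → Inner i (partner (P⁻ i) x)
    partner-inner {x} (x∈P⁻ , x≢t) = partner-∈ (P⁻ i) x∈P⁻ , λ y≡t → x≢t (begin
      x                                 ≡⟨ inner-involutive x ⟨
      partner (P⁻ i) (partner (P⁻ i) x) ≡⟨ cong (partner (P⁻ i)) y≡t ⟩
      partner (P⁻ i) t                  ≡⟨ t-fixed ⟩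
      t                                 ∎)
      where open ≡-Reasoning

    ∉⇒inner : ∀ {j x} → x ∈ P i → x ∉ P j → Inner i x
    ∉⇒inner {j} x∈P x∉Pj =
      ∈-drop1 walk x∈P (λ { refl → x∉Pj (start∈ (proj₁ (path j))) }) ,
      λ { refl → x∉Pj (end∈ (proj₁ (path j))) }

    inner⇒∉ : ∀ {j x} → i ≢ j → Inner i x → x ∉ P j
    inner⇒∉ {j} {x} i≢j inner x∈Pj =
      [ inner⇒≢s inner , proj₂ inner ] (internally-disjoint i j i≢j x (inner⇒∈ inner) x∈Pj)

    inner⇒cover : ∀ {x} → Inner i x → proj₁ (cover x) ≡ i
    inner⇒cover {x} inner with proj₁ (cover x) ≟ i
    ... | yes i′≡i = i′≡i
    ... | no i′≢i  = contradiction (proj₂ (cover x)) (inner⇒∉ (≢-sym i′≢i) inner)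

  module _ (j : Fin k) where

    mateⱼ : V → V
    mateⱼ x with x ∈? P j
    ... | yes _ = partner (P j) x
    ... | no _  = partner (P⁻ (proj₁ (cover x))) x

    mate-on-P : ∀ {x} → x ∈ P j → mateⱼ x ≡ partner (P j) x
    mate-on-P {x} x∈Pj with x ∈? P j
    ... | yes _    = refl
    ... | no x∉Pj  = contradiction x∈Pj x∉Pj

    mate-on-inner : ∀ {i x} → i ≢ j → Inner i x → mateⱼ x ≡ partner (P⁻ i) x
    mate-on-inner {i} {x} i≢j inner with x ∈? P j
    ... | yes x∈Pj = contradiction x∈Pj (inner⇒∉ i≢j inner)
    ... | no _     = cong (λ i → partner (P⁻ i) x) (inner⇒cover inner)

    classify : ∀ x → x ∈ P j ⊎ ∃ λ i → i ≢ j × Inner i x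
    classify x with x ∈? P j | cover x
    ... | yes x∈Pj | _        = inj₁ x∈Pj
    ... | no x∉Pj  | i , x∈Pi =
      inj₂ (i , (λ i≡j → x∉Pj (subst (λ i → x ∈ P i) i≡j x∈Pi)) , ∉⇒inner x∈Pi x∉Pj)

    mateⱼ-adjacent : ∀ x → Adj G x (mateⱼ x)
    mateⱼ-adjacent x with classify x
    ... | inj₁ x∈Pj =
      subst (Adj G x) (sym (mate-on-P x∈Pj)) (oddWalk-partner-adjacent (proj₁ (path j)) (odd j) x∈Pj)
    ... | inj₂ (i , i≢j , inner) =
      subst (Adj G x) (sym (mate-on-inner i≢j inner)) (inner-adjacent inner)

    mateⱼ-involutive : ∀ x → mateⱼ (mateⱼ x) ≡ x
    mateⱼ-involutive x with classify x
    ... | inj₁ x∈Pj = begin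
      mateⱼ (mateⱼ x)                 ≡⟨ cong mateⱼ (mate-on-P x∈Pj) ⟩
      mateⱼ (partner (P j) x)         ≡⟨ mate-on-P (partner-∈ (P j) x∈Pj) ⟩
      partner (P j) (partner (P j) x) ≡⟨ partner-involutive (proj₂ (path j)) x ⟩
      x                               ∎
      where open ≡-Reasoning
    ... | inj₂ (i , i≢j , inner) = begin
      mateⱼ (mateⱼ x)                   ≡⟨ cong mateⱼ (mate-on-inner i≢j inner) ⟩
      mateⱼ (partner (P⁻ i) x)          ≡⟨ mate-on-inner i≢j (partner-inner inner) ⟩
      partner (P⁻ i) (partner (P⁻ i) x) ≡⟨ inner-involutive x ⟩
      x                                 ∎
      where open ≡-Reasoning

    matching : PerfectMatching G
    matching = record
      { mate = mateⱼ ; mate-adjacent = mateⱼ-adjacent ; mate-involutive = mateⱼ-involutive }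

  edge-matched : (∀ i → ∃ λ j → j ≢ i) →
                 ∀ i xs {u v ys} → P i ≡ xs ++ u ∷ v ∷ ys → Adj G u v →
                 Σ (PerfectMatching G) λ M → mate M u ≡ v
  edge-matched another i xs {u} {v} P≡ uv with partner-consecutive xs P≡ (proj₂ (path i))
  ... | inj₁ u↦v = matching i , trans (mate-on-P i u∈P) u↦v
    where
    u∈P : u ∈ P i
    u∈P = subst (u ∈_) (sym P≡) (∈-++⁺ʳ xs (here refl))
  ... | inj₂ u↦v = matching j , trans (mate-on-inner j (≢-sym j≢i) (moved⇒inner u-moved)) u↦v
    where
    j : Fin k
    j = proj₁ (another i)
    j≢i : j ≢ i
    j≢i = proj₂ (another i)
    u-moved : partner (P⁻ i) u ≢ u
    u-moved u↦u = irrefl G (subst (Adj G u) (trans (sym u↦v) u↦u) uv)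

  every-edge-matched : (∀ i → ∃ λ j → j ≢ i) →
                       (∀ u v → Adj G u v → ∃ λ i → Consecutive G u v (P i)) →
                       EveryEdgeInPerfectMatching G
  every-edge-matched another consecutive u v uv with consecutive u v uv
  ... | i , inj₁ (xs , _ , P≡) = edge-matched another i xs P≡ uv
  ... | i , inj₂ (xs , _ , P≡) =
    let M , v↦u = edge-matched another i xs P≡ (Graph.sym G uv)
    in M , trans (cong (mate M) (sym v↦u)) (mate-involutive M v)

module _ {G : Graph} (M : PerfectMatching G) {X Y : Subset (n G)}
  (X→Y : ∀ {x} → x Subset.∈ X → mate M x Subset.∈ Y)
  (Y→X : ∀ {y} → y Subset.∈ Y → mate M y Subset.∈ X) where

  mate-defends : ∀ {u v} → mate M u ≡ v → u Subset.∈ X ⊎ v Subset.∈ X →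
                 IsDefense G X u v (mate M) × IsImage G X (mate M) Y
  mate-defends {u} {v} u↦v uv-covered =
    ( (λ x _ → inj₂ (mate-adjacent M x))
    , (λ _ _ _ _ → mate-injective M)
    , [ (λ u∈X → inj₁ (u∈X , u↦v)) , (λ v∈X → inj₂ (v∈X , v↦u)) ] uv-covered )
    , λ w → (λ w∈Y → mate M w , Y→X w∈Y , mate-involutive M w)
          , (λ (x , x∈X , x↦w) → subst (Subset._∈ Y) x↦w (X→Y x∈X))
    where
    v↦u : mate M v ≡ u
    v↦u = trans (cong (mate M) (sym u↦v)) (mate-involutive M u)

module Bipartite {G : Graph} {A B : Subset (n G)} (bipartition : IsBipartition G A B) where

  open import Data.Fin.Subset.Properties using (_∈?_)

  private
    sides-disjoint : ∀ v → v Subset.∈ A → v Subset.∈ B → ⊥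
    sides-disjoint = proj₁ (proj₂ bipartition)
    edge-crosses : ∀ u v → Adj G u v →
                   (u Subset.∈ A × v Subset.∈ B) ⊎ (u Subset.∈ B × v Subset.∈ A)
    edge-crosses = proj₂ (proj₂ bipartition)

  A-vertexCover : IsVertexCover G A
  A-vertexCover u v uv = [ inj₁ ∘ proj₁ , inj₂ ∘ proj₂ ] (edge-crosses u v uv)

  B-vertexCover : IsVertexCover G B
  B-vertexCover u v uv = [ inj₂ ∘ proj₂ , inj₁ ∘ proj₁ ] (edge-crosses u v uv)

  module _ (M : PerfectMatching G) where

    mate-A→B : ∀ {x} → x Subset.∈ A → mate M x Subset.∈ B
    mate-A→B {x} x∈A with edge-crosses x (mate M x) (mate-adjacent M x)
    ... | inj₁ (_ , y∈B) = y∈B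
    ... | inj₂ (x∈B , _) = contradiction x∈B (sides-disjoint x x∈A)

    mate-B→A : ∀ {x} → x Subset.∈ B → mate M x Subset.∈ A
    mate-B→A {x} x∈B with edge-crosses x (mate M x) (mate-adjacent M x)
    ... | inj₁ (x∈A , _) = contradiction x∈B (sides-disjoint x x∈A)
    ... | inj₂ (_ , y∈A) = y∈A

    ∣A∣≡∣B∣ : ∣ A ∣ ≡ ∣ B ∣
    ∣A∣≡∣B∣ = ≤-antisym
      (injectiveOn⇒∣p∣≤∣q∣ A B (mate M) mate-A→B (λ _ _ → mate-injective M))
      (injectiveOn⇒∣p∣≤∣q∣ B A (mate M) mate-B→A (λ _ _ → mate-injective M))

    ∣A∣≤∣vertexCover∣ : ∀ {U} → IsVertexCover G U → ∣ A ∣ ≤ ∣ U ∣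
    ∣A∣≤∣vertexCover∣ {U} U-covers =
      injectiveOn⇒∣p∣≤∣q∣ A U guard guard∈U guard-injective
      where
      guard : Fin (n G) → Fin (n G)
      guard x with x ∈? U
      ... | yes _ = x
      ... | no _  = mate M x

      guard∈U : ∀ {x} → x Subset.∈ A → guard x Subset.∈ U
      guard∈U {x} _ with x ∈? U
      ... | yes x∈U = x∈U
      ... | no x∉U with U-covers x (mate M x) (mate-adjacent M x)
      ...   | inj₁ x∈U  = contradiction x∈U x∉U
      ...   | inj₂ mx∈U = mx∈U

      guard-injective : ∀ {x y} → x Subset.∈ A → y Subset.∈ A → guard x ≡ guard y → x ≡ y
      guard-injective {x} {y} x∈A y∈A with x ∈? U | y ∈? U
      ... | yes _ | yes _ = id
      ... | yes _ | no _  = λ x≡my →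
        contradiction (subst (Subset._∈ B) (sym x≡my) (mate-A→B y∈A)) (sides-disjoint x x∈A)
      ... | no _  | yes _ = λ mx≡y →
        contradiction (subst (Subset._∈ B) mx≡y (mate-A→B x∈A)) (sides-disjoint y y∈A)
      ... | no _  | no _  = mate-injective M

  Sides : Subset (n G) → Set
  Sides U = U ≡ A ⊎ U ≡ B

  sides-EVCClass : PerfectMatching G → EveryEdgeInPerfectMatching G → IsEVCClass G Sides ∣ A ∣
  sides-EVCClass M matched = (A , inj₁ refl) , side-covers , defend
    where
    side-covers : ∀ U → Sides U → IsVertexCover G U × ∣ U ∣ ≡ ∣ A ∣
    side-covers _ (inj₁ refl) = A-vertexCover , refl
    side-covers _ (inj₂ refl) = B-vertexCover , sym (∣A∣≡∣B∣ M)

    defend : ∀ U → Sides U → ∀ u v → Adj G u v →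
             Σ (Fin (n G) → Fin (n G)) λ φ →
               IsDefense G U u v φ × Σ (Subset (n G)) λ W → Sides W × IsImage G U φ W
    defend _ (inj₁ refl) u v uv =
      let M′ , u↦v = matched u v uv
          defense , image = mate-defends M′ (mate-A→B M′) (mate-B→A M′) u↦v (A-vertexCover u v uv)
      in mate M′ , defense , B , inj₂ refl , image
    defend _ (inj₂ refl) u v uv =
      let M′ , u↦v = matched u v uv
          defense , image = mate-defends M′ (mate-B→A M′) (mate-A→B M′) u↦v (B-vertexCover u v uv)
      in mate M′ , defense , A , inj₁ refl , image

  sides-minimumEVCClass : PerfectMatching G → EveryEdgeInPerfectMatching G →
    Σ ℕ λ m → IsVCNumber G m × IsEVCNumber G m × IsEVCClass G Sides m
  sides-minimumEVCClass M matched =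
    ∣ A ∣ , ((A , A-vertexCover , refl) , λ _ → ∣A∣≤∣vertexCover∣ M) ,
    ((Sides , class) , minimal) , class
    where
    class : IsEVCClass G Sides ∣ A ∣
    class = sides-EVCClass M matched
    minimal : ∀ 𝒰 m → IsEVCClass G 𝒰 m → ∣ A ∣ ≤ m
    minimal _ _ ((U , U∈𝒰) , sized , _) =
      let U-covers , ∣U∣≡m = sized U U∈𝒰
      in subst (∣ A ∣ ≤_) ∣U∣≡m (∣A∣≤∣vertexCover∣ M U-covers)

another : ∀ {k} (i : Fin (suc (suc k))) → ∃ λ j → j ≢ i
another zero    = suc zero , λ ()
another (suc _) = zero , λ ()

theorem9 : (G : Graph) (k : ℕ) → 3 ≤ k → IsOddMelon G k →
           (A B : Subset (n G)) → IsBipartition G A B →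
           Σ ℕ λ m → IsVCNumber G m × IsEVCNumber G m ×
             IsEVCClass G (λ U → U ≡ A ⊎ U ≡ B) m
theorem9 G (suc (suc k)) (s≤s (s≤s _)) (_ , _ , _ , P , path , odd , _ , disjoint , cover , consecutive)
         A B bipartition =
  sides-minimumEVCClass (matching zero) (every-edge-matched another consecutive)
  where
  open OddMelon G P path odd disjoint cover
  open Bipartite bipartition
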